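{- There is an absolute constant $C>0$ such that for all positive integers $n,k$, $Z_{\mathsf{UGIG}}(n;k)\ge 3(k-1)n - C\,k\sqrt{kn}$.
   Context: A unit grid intersection graph (class $\mathsf{UGIG}$) is a bipartite graph $G=(U\cup V,E)$ admitting a map of $U$ to horizontal segments of length $1$ and $V$ to vertical segments of length $1$ in $\mathbb{R}^2$ such that $uv\in E$ iff the segments intersect. $Z_{\mathcal{C}}(n;k)$ is the maximum number of edges of a graph $G=(U\cup V,E)\in\mathcal{C}$ with $|U|=|V|=n$ not containing $K_{k,k}$ as a subgraph. -}

module Defs where

open import Data.Nat using (ℕ; zero; suc; _+_; _*_; _∸_; _^_)
open import Data.Fin using (Fin)
import Data.Fin as Fin
open import Data.Fin.Subset using (Subset; _∈_; ∣_∣)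
open import Data.Bool using (Bool; true; false; if_then_else_)
open import Data.Rational using (ℚ; 1ℚ) renaming (_≤_ to _≤ℚ_; _+_ to _+ℚ_)
open import Data.Product using (Σ; _×_; ∃)
open import Relation.Binary.PropositionalEquality using (_≡_)
open import Function.Bundles using (_⇔_)

-- A bipartite graph with sides U = Fin n and V = Fin n, given by its
-- (decidable) biadjacency relation: Adj u v ≡ true iff uv ∈ E.
BipGraph : ℕ → Set
BipGraph n = Fin n → Fin n → Bool

sumFin : (n : ℕ) → (Fin n → ℕ) → ℕ
sumFin zero    f = 0
sumFin (suc n) f = f Fin.zero + sumFin n (λ i → f (Fin.suc i))

edges : {n : ℕ} → BipGraph n → ℕ
edges {n} G = sumFin n (λ u → sumFin n (λ v → if G u v then 1 else 0))

-- A horizontal unit segment [x, x+1] × {y} is encoded by (x , y);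
-- a vertical unit segment {a} × [b, b+1] is encoded by (a , b).
-- They intersect iff x ≤ a ≤ x+1 and b ≤ y ≤ b+1.
Intersects : ℚ × ℚ → ℚ × ℚ → Set
Intersects (x Data.Product., y) (a Data.Product., b) =
  (x ≤ℚ a) × (a ≤ℚ x +ℚ 1ℚ) × (b ≤ℚ y) × (y ≤ℚ b +ℚ 1ℚ)

IsUGIG : {n : ℕ} → BipGraph n → Set
IsUGIG {n} G =
  Σ (Fin n → ℚ × ℚ) λ hor →
  Σ (Fin n → ℚ × ℚ) λ ver →
  ∀ u v → (G u v ≡ true) ⇔ Intersects (hor u) (ver v)

-- G contains K_{k,k} as a subgraph (in a bipartite graph a K_{k,k} must have
-- one side in U and the other in V).
ContainsKkk : {n : ℕ} → ℕ → BipGraph n → Set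
ContainsKkk {n} k G =
  Σ (Subset n) λ A → Σ (Subset n) λ B →
  (∣ A ∣ ≡ k) × (∣ B ∣ ≡ k) × (∀ u v → u ∈ A → v ∈ B → G u v ≡ true)

-- Put a horizontal and a vertical unit segment at the point (i + j/2 , j) of a sheared
-- square grid. The horizontal segment of cell (i , j) then meets exactly the vertical
-- segments of the cells (i , j), (i+1 , j) and (i+1 , j-1), and this bipartite graph on the
-- cells has no 4-cycle. Taking r = k - 1 copies of every segment multiplies the number of
-- edges by r², while a K_{k,k} in the blown-up graph would meet two distinct cells on each
-- side and so give a 4-cycle. With about n/r cells in a square of side w ≈ √(n/r) only the
-- O(w) boundary cells lose neighbours, so 3(k-1)n - e = O(r² w) = O(k √(kn)).
module Submission where

open import Defs
open import Data.Bool using (true; if_then_else_)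
open import Data.Bool.Properties using (T-≡)
open import Data.Fin using (Fin; toℕ)
open import Data.Fin.Properties using (any?)
open import Data.Fin.Subset using (Subset; _∈_; ∣_∣; Nonempty; inside; outside)
open import Data.Fin.Subset.Properties using (_∈?_)
import Data.Integer as ℤ
import Data.Integer.Properties as ℤ
open import Data.Nat as ℕ using (ℕ; zero; suc; _+_; _*_; _∸_; _^_; _/_; _%_; _≤_; _<_; z≤n; s≤s; NonZero)
open import Data.Nat.Divisibility using (divides)
open import Data.Nat.DivMod
import Data.Nat.Properties as ℕ
open import Data.Nat.Tactic.RingSolver using (solve-∀)
open import Data.Product using (Σ; _×_; _,_; proj₁; proj₂)
open import Data.Product.Properties using (≡-dec)
open import Data.Rational as ℚ using (ℚ; 1ℚ; toℚᵘ; fromℚᵘ)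
import Data.Rational.Properties as ℚ
open import Data.Rational.Unnormalised as ℚᵘ using (mkℚᵘ; *≤*; *≡*)
import Data.Rational.Unnormalised.Properties as ℚᵘ
open import Data.Sum using (_⊎_; inj₁; inj₂)
open import Data.Vec.Base using (_∷_; []; here; there)
open import Function.Bundles using (_⇔_; mk⇔; Equivalence)
open import Relation.Binary.Definitions using (DecidableEquality)
open import Relation.Binary.PropositionalEquality
open import Relation.Nullary using (¬_; contradiction)
open import Relation.Nullary.Decidable using (Dec; yes; no; ⌊_⌋; _×-dec_; ¬?; toWitness; fromWitness; decidable-stable)

-- Unit segments with half-integer endpoints

half : ℕ → ℚ
half a = fromℚᵘ (mkℚᵘ (ℤ.+ a) 1)

toℚᵘ-half : ∀ a → toℚᵘ (half a) ℚᵘ.≃ mkℚᵘ (ℤ.+ a) 1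
toℚᵘ-half a = ℚ.toℚᵘ-fromℚᵘ (mkℚᵘ (ℤ.+ a) 1)

half-mono-≤ : ∀ {a b} → a ≤ b → half a ℚ.≤ half b
half-mono-≤ {a} {b} a≤b = ℚ.toℚᵘ-cancel-≤
  (ℚᵘ.≤-respˡ-≃ (ℚᵘ.≃-sym (toℚᵘ-half a)) (ℚᵘ.≤-respʳ-≃ (ℚᵘ.≃-sym (toℚᵘ-half b))
    (*≤* (subst₂ ℤ._≤_ (ℤ.pos-* a 2) (ℤ.pos-* b 2) (ℤ.+≤+ (ℕ.*-monoˡ-≤ 2 a≤b))))))

half-cancel-≤ : ∀ {a b} → half a ℚ.≤ half b → a ≤ b
half-cancel-≤ {a} {b} p
  with *≤* q ← ℚᵘ.≤-respˡ-≃ (toℚᵘ-half a) (ℚᵘ.≤-respʳ-≃ (toℚᵘ-half b) (ℚ.toℚᵘ-mono-≤ p))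
  with ℤ.+≤+ q' ← subst₂ ℤ._≤_ (sym (ℤ.pos-* a 2)) (sym (ℤ.pos-* b 2)) q
  = ℕ.*-cancelʳ-≤ a b 2 q'

half-+-1 : ∀ a → half a ℚ.+ 1ℚ ≡ half (a + 2)
half-+-1 a = ℚ.toℚᵘ-injective (begin-equality
  toℚᵘ (half a ℚ.+ 1ℚ)                ≃⟨ ℚ.toℚᵘ-homo-+ (half a) 1ℚ ⟩
  toℚᵘ (half a) ℚᵘ.+ toℚᵘ 1ℚ           ≃⟨ ℚᵘ.+-cong (toℚᵘ-half a) (ℚ.toℚᵘ-fromℚᵘ (mkℚᵘ (ℤ.+ 1) 0)) ⟩
  mkℚᵘ (ℤ.+ a) 1 ℚᵘ.+ mkℚᵘ (ℤ.+ 1) 0   ≃⟨ *≡* (cong (ℤ._* ℤ.+ 2) numerator) ⟩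
  mkℚᵘ (ℤ.+ (a + 2)) 1                ≃⟨ ℚᵘ.≃-sym (toℚᵘ-half (a + 2)) ⟩
  toℚᵘ (half (a + 2))                 ∎)
  where
  numerator : ℤ.+ a ℤ.* ℤ.+ 1 ℤ.+ ℤ.+ 2 ≡ ℤ.+ (a + 2)
  numerator = trans (cong (ℤ._+ ℤ.+ 2) (ℤ.*-identityʳ (ℤ.+ a))) (sym (ℤ.pos-+ a 2))
  open ℚᵘ.≤-Reasoning

-- In half-units: the horizontal segment [x, x+2] × {y} meets the vertical segment {a} × [b, b+2].
Crosses : ℕ × ℕ → ℕ × ℕ → Set
Crosses (x , y) (a , b) = x ≤ a × a ≤ x + 2 × b ≤ y × y ≤ b + 2

crosses? : ∀ p q → Dec (Crosses p q)
crosses? (x , y) (a , b) = (x ℕ.≤? a) ×-dec (a ℕ.≤? x + 2) ×-dec (b ℕ.≤? y) ×-dec (y ℕ.≤? b + 2)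

halves : ℕ × ℕ → ℚ × ℚ
halves (x , y) = half x , half y

≤+2⇔≤half+1 : ∀ {a b} → a ≤ b + 2 ⇔ half a ℚ.≤ half b ℚ.+ 1ℚ
≤+2⇔≤half+1 {a} {b} rewrite half-+-1 b = mk⇔ half-mono-≤ half-cancel-≤

intersects⇔crosses : ∀ p q → Intersects (halves p) (halves q) ⇔ Crosses p q
intersects⇔crosses (x , y) (a , b) = mk⇔
  (λ (h₁ , h₂ , h₃ , h₄) → half-cancel-≤ h₁ , from ≤+2⇔≤half+1 h₂ , half-cancel-≤ h₃ , from ≤+2⇔≤half+1 h₄)
  (λ (h₁ , h₂ , h₃ , h₄) → half-mono-≤ h₁ , to ≤+2⇔≤half+1 h₂ , half-mono-≤ h₃ , to ≤+2⇔≤half+1 h₄)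
  where open Equivalence

crossingGraph : ∀ {n} → (Fin n → ℕ × ℕ) → (Fin n → ℕ × ℕ) → BipGraph n
crossingGraph P Q u v = ⌊ crosses? (P u) (Q v) ⌋

crossingGraph-isUGIG : ∀ {n} (P Q : Fin n → ℕ × ℕ) → IsUGIG (crossingGraph P Q)
crossingGraph-isUGIG P Q = (λ u → halves (P u)) , (λ v → halves (Q v)) , λ u v → mk⇔
  (λ e → from (intersects⇔crosses (P u) (Q v)) (toWitness (from T-≡ e)))
  (λ i → to T-≡ (fromWitness (to (intersects⇔crosses (P u) (Q v)) i)))
  where open Equivalence

-- The sheared grid

data Near : ℕ × ℕ → ℕ × ℕ → Set where
  same  : ∀ {i j} → Near (i , j) (i , j)
  right : ∀ {i j} → Near (i , j) (suc i , j)
  diag  : ∀ {i j} → Near (i , suc j) (suc i , j)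

RectangleFree : {C : Set} → (C → C → Set) → Set
RectangleFree R = ∀ {a a′ b b′} → R a b → R a′ b → R a b′ → R a′ b′ → a ≡ a′ ⊎ b ≡ b′

Near-rectangleFree : RectangleFree Near
Near-rectangleFree same  same  same  same  = inj₁ refl
Near-rectangleFree same  same  right right = inj₁ refl
Near-rectangleFree same  same  diag  diag  = inj₁ refl
Near-rectangleFree same  right same  right = inj₂ refl
Near-rectangleFree same  right right ()
Near-rectangleFree same  right diag  ()
Near-rectangleFree same  diag  same  diag  = inj₂ refl
Near-rectangleFree same  diag  right ()
Near-rectangleFree same  diag  diag  ()
Near-rectangleFree right same  same  ()
Near-rectangleFree right same  right same  = inj₂ refl
Near-rectangleFree right same  diag  ()
Near-rectangleFree right right same  same  = inj₁ refl
Near-rectangleFree right right right right = inj₁ refl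
Near-rectangleFree right right diag  diag  = inj₁ refl
Near-rectangleFree right diag  same  ()
Near-rectangleFree right diag  right diag  = inj₂ refl
Near-rectangleFree right diag  diag  ()
Near-rectangleFree diag  same  same  ()
Near-rectangleFree diag  same  right ()
Near-rectangleFree diag  same  diag  same  = inj₂ refl
Near-rectangleFree diag  right same  ()
Near-rectangleFree diag  right right ()
Near-rectangleFree diag  right diag  right = inj₂ refl
Near-rectangleFree diag  diag  same  same  = inj₁ refl
Near-rectangleFree diag  diag  right right = inj₁ refl
Near-rectangleFree diag  diag  diag  diag  = inj₁ refl

-- Row j is shifted by j half-units, so that the horizontal segment of a cell also reaches the
-- vertical segment of its lower right neighbour.
cellPoint : ℕ × ℕ → ℕ × ℕ
cellPoint (i , j) = 2 * i + j , 2 * j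

2i+j+2≡2[1+i]+j : ∀ i j → 2 * i + j + 2 ≡ 2 * suc i + j
2i+j+2≡2[1+i]+j = solve-∀

2j+2≡2[1+j] : ∀ j → 2 * j + 2 ≡ 2 * suc j
2j+2≡2[1+j] = solve-∀

near⇒crosses : ∀ {p q} → Near p q → Crosses (cellPoint p) (cellPoint q)
near⇒crosses {i , j} same  = ℕ.≤-refl , ℕ.m≤m+n _ 2 , ℕ.≤-refl , ℕ.m≤m+n _ 2
near⇒crosses {i , j} right =
  ℕ.≤-trans (ℕ.m≤m+n _ 2) (ℕ.≤-reflexive (2i+j+2≡2[1+i]+j i j)) , ℕ.≤-reflexive (sym (2i+j+2≡2[1+i]+j i j)) ,
  ℕ.≤-refl , ℕ.m≤m+n _ 2
near⇒crosses {i , suc j} diag =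
  ℕ.≤-trans (ℕ.m≤m+n _ 1) (ℕ.≤-reflexive (shift i j)) ,
  ℕ.≤-trans (ℕ.≤-reflexive (sym (shift i j))) (ℕ.+-monoʳ-≤ _ (s≤s z≤n)) ,
  ℕ.≤-trans (ℕ.m≤m+n _ 2) (ℕ.≤-reflexive (2j+2≡2[1+j] j)) , ℕ.≤-reflexive (sym (2j+2≡2[1+j] j))
  where
  shift : ∀ i j → 2 * i + suc j + 1 ≡ 2 * suc i + j
  shift = solve-∀

≤≤1+⇒≡∨≡1+ : ∀ {a b} → a ≤ b → b ≤ suc a → b ≡ a ⊎ b ≡ suc a
≤≤1+⇒≡∨≡1+ a≤b b≤1+a with ℕ.m≤n⇒m<n∨m≡n a≤b
... | inj₁ a<b = inj₂ (ℕ.≤-antisym b≤1+a a<b)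
... | inj₂ a≡b = inj₁ (sym a≡b)

same-row : ∀ {i i′ j} → 2 * i + j ≤ 2 * i′ + j → 2 * i′ + j ≤ 2 * i + j + 2 → Near (i , j) (i′ , j)
same-row {i} {i′} {j} h₁ h₂
  with ≤≤1+⇒≡∨≡1+ {i} {i′} (ℕ.*-cancelˡ-≤ 2 (ℕ.+-cancelʳ-≤ j _ _ h₁))
                  (ℕ.*-cancelˡ-≤ 2 (ℕ.+-cancelʳ-≤ j _ _ (ℕ.≤-trans h₂ (ℕ.≤-reflexive (2i+j+2≡2[1+i]+j i j)))))
... | inj₁ refl = same
... | inj₂ refl = right

row-below : ∀ {i i′ j} → 2 * i + suc j ≤ 2 * i′ + j → 2 * i′ + j ≤ 2 * i + suc j + 2 → Near (i , suc j) (i′ , j)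
row-below {i} {i′} {j} h₁ h₂ with ℕ.≤-antisym upper lower
  where
  lower : suc i ≤ i′
  lower = ℕ.*-cancelˡ-< 2 i i′ (ℕ.+-cancelʳ-≤ j _ _ (ℕ.≤-trans (ℕ.≤-reflexive (sym (ℕ.+-suc (2 * i) j))) h₁))
  shift : ∀ i j → suc (2 * i + suc j + 2) ≡ 2 * suc (suc i) + j
  shift = solve-∀
  upper : i′ ≤ suc i
  upper = ℕ.≤-pred (ℕ.*-cancelˡ-< 2 i′ (suc (suc i)) (ℕ.+-cancelʳ-< j _ _ (ℕ.≤-trans (s≤s h₂) (ℕ.≤-reflexive (shift i j)))))
... | refl = diag

crosses⇒near : ∀ p q → Crosses (cellPoint p) (cellPoint q) → Near p q
crosses⇒near (i , j) (i′ , j′) (h₁ , h₂ , h₃ , h₄)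
  with ≤≤1+⇒≡∨≡1+ {j′} {j} (ℕ.*-cancelˡ-≤ 2 h₃) (ℕ.*-cancelˡ-≤ 2 (ℕ.≤-trans h₄ (ℕ.≤-reflexive (2j+2≡2[1+j] j′))))
... | inj₁ refl = same-row h₁ h₂
... | inj₂ refl = row-below h₁ h₂

-- Blowing up a rectangle-free relation

∣p∣≡1+k⇒nonempty : ∀ {n k} (p : Subset n) → ∣ p ∣ ≡ suc k → Nonempty p
∣p∣≡1+k⇒nonempty (inside ∷ p)  _ = Fin.zero , here
∣p∣≡1+k⇒nonempty (outside ∷ p) e with u , u∈p ← ∣p∣≡1+k⇒nonempty p e = Fin.suc u , there u∈p

∣p∣≤-window : ∀ {n} (p : Subset n) lo ℓ → (∀ {u} → u ∈ p → lo ≤ toℕ u × toℕ u < lo + ℓ) → ∣ p ∣ ≤ ℓ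
∣p∣≤-window []            lo       ℓ       h = z≤n
∣p∣≤-window (outside ∷ p) zero     ℓ       h =
  ∣p∣≤-window p zero ℓ (λ u∈p → z≤n , ℕ.<⇒≤ (proj₂ (h (there u∈p))))
∣p∣≤-window (outside ∷ p) (suc lo) ℓ       h =
  ∣p∣≤-window p lo ℓ (λ u∈p → let lo≤u , u<hi = h (there u∈p) in ℕ.s≤s⁻¹ lo≤u , ℕ.s<s⁻¹ u<hi)
∣p∣≤-window (inside ∷ p)  zero     zero    h with () ← proj₂ (h here)
∣p∣≤-window (inside ∷ p)  zero     (suc ℓ) h =
  s≤s (∣p∣≤-window p zero ℓ (λ u∈p → z≤n , ℕ.s<s⁻¹ (proj₂ (h (there u∈p)))))
∣p∣≤-window (inside ∷ p)  (suc lo) ℓ       h with () ← proj₁ (h here)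

AtMost-to-one : {C : Set} → ℕ → ∀ {n} → (Fin n → C) → Set
AtMost-to-one r {n} f = ∀ (p : Subset n) c → (∀ {u} → u ∈ p → f u ≡ c) → ∣ p ∣ ≤ r

module _ {C : Set} (_≟_ : DecidableEquality C) {R : C → C → Set} (R-free : RectangleFree R) where

  -- A K_{r+1,r+1} meets two values of f on one side, and these have only one common R-neighbour.
  ¬ContainsKkk-blowUp : ∀ {n r} (G : BipGraph n) (f : Fin n → C) → AtMost-to-one r f →
    (∀ {u v} → G u v ≡ true → R (f u) (f v)) → ¬ ContainsKkk (suc r) G
  ¬ContainsKkk-blowUp {r = r} G f small edge⇒R (A , B , ∣A∣≡1+r , ∣B∣≡1+r , complete)
    with u₀ , u₀∈A ← ∣p∣≡1+k⇒nonempty A ∣A∣≡1+r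
       | v₀ , v₀∈B ← ∣p∣≡1+k⇒nonempty B ∣B∣≡1+r
       | any? (λ u → (u ∈? A) ×-dec ¬? (f u ≟ f u₀))
  ... | yes (u₁ , u₁∈A , fu₁≢fu₀) = ℕ.1+n≰n (subst (_≤ r) ∣B∣≡1+r (small B (f v₀) B-constant))
    where
    R-at : ∀ {u v} → u ∈ A → v ∈ B → R (f u) (f v)
    R-at u∈A v∈B = edge⇒R (complete _ _ u∈A v∈B)
    B-constant : ∀ {v} → v ∈ B → f v ≡ f v₀
    B-constant v∈B with R-free (R-at u₀∈A v∈B) (R-at u₁∈A v∈B) (R-at u₀∈A v₀∈B) (R-at u₁∈A v₀∈B)
    ... | inj₁ fu₀≡fu₁ = contradiction (sym fu₀≡fu₁) fu₁≢fu₀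
    ... | inj₂ fv≡fv₀  = fv≡fv₀
  ... | no ∄u = ℕ.1+n≰n (subst (_≤ r) ∣A∣≡1+r (small A (f u₀) A-constant))
    where
    A-constant : ∀ {u} → u ∈ A → f u ≡ f u₀
    A-constant {u} u∈A = decidable-stable (f u ≟ f u₀) (λ fu≢fu₀ → ∄u (u , u∈A , fu≢fu₀))

∑< : ℕ → (ℕ → ℕ) → ℕ
∑< zero    f = 0
∑< (suc n) f = f 0 + ∑< n (λ i → f (suc i))

sumFin≡∑< : ∀ n (f : ℕ → ℕ) → sumFin n (λ u → f (toℕ u)) ≡ ∑< n f
sumFin≡∑< zero    f = refl
sumFin≡∑< (suc n) f = cong (f 0 +_) (sumFin≡∑< n (λ i → f (suc i)))

sumFin-cong : ∀ n {f g : Fin n → ℕ} → (∀ u → f u ≡ g u) → sumFin n f ≡ sumFin n g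
sumFin-cong zero    f≗g = refl
sumFin-cong (suc n) f≗g = cong₂ _+_ (f≗g _) (sumFin-cong n (λ u → f≗g _))

∑<-cong : ∀ n {f g} → (∀ i → i < n → f i ≡ g i) → ∑< n f ≡ ∑< n g
∑<-cong zero    f≗g = refl
∑<-cong (suc n) f≗g = cong₂ _+_ (f≗g 0 (s≤s z≤n)) (∑<-cong n (λ i i<n → f≗g (suc i) (s≤s i<n)))

∑<-mono-≤ : ∀ n {f g} → (∀ i → i < n → f i ≤ g i) → ∑< n f ≤ ∑< n g
∑<-mono-≤ zero    f≤g = z≤n
∑<-mono-≤ (suc n) f≤g = ℕ.+-mono-≤ (f≤g 0 (s≤s z≤n)) (∑<-mono-≤ n (λ i i<n → f≤g (suc i) (s≤s i<n)))

∑<-monoˡ-≤ : ∀ {m n} f → m ≤ n → ∑< m f ≤ ∑< n f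
∑<-monoˡ-≤ {zero}          f m≤n       = z≤n
∑<-monoˡ-≤ {suc m} {suc n} f (s≤s m≤n) = ℕ.+-monoʳ-≤ (f 0) (∑<-monoˡ-≤ (λ i → f (suc i)) m≤n)

∑<-+ : ∀ m n f → ∑< (m + n) f ≡ ∑< m f + ∑< n (λ i → f (m + i))
∑<-+ zero    n f = refl
∑<-+ (suc m) n f = trans (cong (f 0 +_) (∑<-+ m n (λ i → f (suc i)))) (sym (ℕ.+-assoc (f 0) _ _))

∑<-blocks : ∀ q d f → ∑< (q * d) f ≡ ∑< q (λ g → ∑< d (λ c → f (g * d + c)))
∑<-blocks zero    d f = refl
∑<-blocks (suc q) d f = trans (∑<-+ d (q * d) f) (cong (∑< d f +_) (trans (∑<-blocks q d (λ i → f (d + i)))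
  (∑<-cong q (λ g _ → ∑<-cong d (λ c _ → cong f (sym (ℕ.+-assoc d (g * d) c)))))))

∑<-const : ∀ n c → ∑< n (λ _ → c) ≡ n * c
∑<-const zero    c = refl
∑<-const (suc n) c = cong (c +_) (∑<-const n c)

∑<-*ˡ : ∀ n c f → ∑< n (λ i → c * f i) ≡ c * ∑< n f
∑<-*ˡ zero    c f = sym (ℕ.*-zeroʳ c)
∑<-*ˡ (suc n) c f = trans (cong (c * f 0 +_) (∑<-*ˡ n c (λ i → f (suc i)))) (sym (ℕ.*-distribˡ-+ c (f 0) _))

∑<-pick : ∀ n f {a} → a < n → f a ≤ ∑< n f
∑<-pick (suc n) f {zero}  _         = ℕ.m≤m+n (f 0) _
∑<-pick (suc n) f {suc a} (s≤s a<n) = ℕ.≤-trans (∑<-pick n (λ i → f (suc i)) a<n) (ℕ.m≤n+m _ (f 0))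

∑<-pick₂ : ∀ n f {a b} → a < b → b < n → f a + f b ≤ ∑< n f
∑<-pick₂ (suc n) f {zero}  {suc b} _         (s≤s b<n) = ℕ.+-monoʳ-≤ (f 0) (∑<-pick n (λ i → f (suc i)) b<n)
∑<-pick₂ (suc n) f {suc a} {suc b} (s≤s a<b) (s≤s b<n) =
  ℕ.≤-trans (∑<-pick₂ n (λ i → f (suc i)) a<b b<n) (ℕ.m≤n+m _ (f 0))

∑<-pick₃ : ∀ n f {a b c} → a < b → b < c → c < n → f a + f b + f c ≤ ∑< n f
∑<-pick₃ (suc n) f {zero}  {suc b} {suc c} _         b<c       (s≤s c<n) =
  ℕ.≤-trans (ℕ.≤-reflexive (ℕ.+-assoc (f 0) _ _)) (ℕ.+-monoʳ-≤ (f 0) (∑<-pick₂ n (λ i → f (suc i)) (ℕ.s<s⁻¹ b<c) c<n))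
∑<-pick₃ (suc n) f {suc a} {suc b} {suc c} (s≤s a<b) (s≤s b<c) (s≤s c<n) =
  ℕ.≤-trans (∑<-pick₃ n (λ i → f (suc i)) a<b b<c c<n) (ℕ.m≤n+m _ (f 0))

[q*d+c]/d≡q : ∀ q {c} d .{{_ : NonZero d}} → c < d → (q * d + c) / d ≡ q
[q*d+c]/d≡q q {c} d c<d = begin
  (q * d + c) / d      ≡⟨ +-distrib-/-∣ˡ _ (divides q refl) ⟩
  q * d / d + c / d    ≡⟨ cong₂ _+_ (m*n/n≡m q d) (m<n⇒m/n≡0 c<d) ⟩
  q + 0                ≡⟨ ℕ.+-identityʳ q ⟩
  q                    ∎
  where open ≡-Reasoning

[q*d+c]%d≡c : ∀ q {c} d .{{_ : NonZero d}} → c < d → (q * d + c) % d ≡ c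
[q*d+c]%d≡c q {c} d c<d = trans (cong (_% d) (ℕ.+-comm (q * d) c)) (trans ([m+kn]%n≡m%n c q d) (m<n⇒m%n≡m c<d))

/≡⇒window : ∀ t r .{{_ : NonZero r}} {g} → t / r ≡ g → g * r ≤ t × t < g * r + r
/≡⇒window t r refl = m/n*n≤m t r , (begin-strict
  t                    ≡⟨ m≡m%n+[m/n]*n t r ⟩
  t % r + t / r * r    <⟨ ℕ.+-monoˡ-< (t / r * r) (m%n<n t r) ⟩
  r + t / r * r        ≡⟨ ℕ.+-comm r _ ⟩
  t / r * r + r        ∎)
  where open ℕ.≤-Reasoning

∑<-blowUp : ∀ m r .{{_ : NonZero r}} F → ∑< (m * r) (λ a → F (a / r)) ≡ r * ∑< m F
∑<-blowUp m r F = begin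
  ∑< (m * r) (λ a → F (a / r))                     ≡⟨ ∑<-blocks m r _ ⟩
  ∑< m (λ g → ∑< r (λ c → F ((g * r + c) / r)))
    ≡⟨ ∑<-cong m (λ g _ → ∑<-cong r (λ c c<r → cong F ([q*d+c]/d≡q g r c<r))) ⟩
  ∑< m (λ g → ∑< r (λ _ → F g))                     ≡⟨ ∑<-cong m (λ g _ → ∑<-const r (F g)) ⟩
  ∑< m (λ g → r * F g)                              ≡⟨ ∑<-*ˡ m r F ⟩
  r * ∑< m F                                        ∎
  where open ≡-Reasoning

-- Vertex t (of either side) lies in group t / r; the groups fill a grid of width w row by row.
module SquareGrid (r′ w′ : ℕ) where

  r w : ℕ
  r = suc r′
  w = suc w′

  cell : ℕ → ℕ × ℕ
  cell g = g % w , g / w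

  cell-rowMajor : ∀ j {i} → i < w → cell (j * w + i) ≡ (i , j)
  cell-rowMajor j i<w = cong₂ _,_ ([q*d+c]%d≡c j w i<w) ([q*d+c]/d≡q j w i<w)

  cell≡⇒ : ∀ {g i j} → cell g ≡ (i , j) → g ≡ i + j * w
  cell≡⇒ {g} refl = m≡m%n+[m/n]*n g w

  point : ℕ → ℕ × ℕ
  point t = cellPoint (cell (t / r))

  graph : (n : ℕ) → BipGraph n
  graph n = crossingGraph (λ u → point (toℕ u)) (λ u → point (toℕ u))

  graph-isUGIG : ∀ n → IsUGIG (graph n)
  graph-isUGIG n = crossingGraph-isUGIG _ _

  groupCell-atMost-r : ∀ {n} → AtMost-to-one r {n} (λ u → cell (toℕ u / r))
  groupCell-atMost-r p (i , j) inFibre =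
    ∣p∣≤-window p ((i + j * w) * r) r (λ {u} u∈p → /≡⇒window (toℕ u) r (cell≡⇒ (inFibre u∈p)))

  graph-¬ContainsKkk : ∀ n → ¬ ContainsKkk (suc r) (graph n)
  graph-¬ContainsKkk n = ¬ContainsKkk-blowUp (≡-dec ℕ._≟_ ℕ._≟_) Near-rectangleFree (graph n) _ groupCell-atMost-r
    (λ {u} {v} e → crosses⇒near _ _ (toWitness (Equivalence.from T-≡ e)))

  cellEdge : ℕ → ℕ → ℕ
  cellEdge g g′ = if ⌊ crosses? (cellPoint (cell g)) (cellPoint (cell g′)) ⌋ then 1 else 0

  cellEdge-near : ∀ {g g′} → Near (cell g) (cell g′) → cellEdge g g′ ≡ 1
  cellEdge-near near = cong (λ b → if b then 1 else 0) (Equivalence.to T-≡ (fromWitness (near⇒crosses near)))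

  edges≡∑< : ∀ n → edges (graph n) ≡ ∑< n (λ a → ∑< n (λ b → cellEdge (a / r) (b / r)))
  edges≡∑< n = trans (sumFin-cong n (λ u → sumFin≡∑< n (λ b → cellEdge (toℕ u / r) (b / r))))
                     (sumFin≡∑< n (λ a → ∑< n (λ b → cellEdge (a / r) (b / r))))

  edges-≥ : ∀ m n → m * r ≤ n → r * (r * ∑< m (λ g → ∑< m (cellEdge g))) ≤ edges (graph n)
  edges-≥ m n m*r≤n = begin
    r * (r * ∑< m (λ g → ∑< m (cellEdge g)))                  ≡⟨ cong (r *_) (∑<-*ˡ m r _) ⟨
    r * ∑< m (λ g → r * ∑< m (cellEdge g))                    ≡⟨ ∑<-blowUp m r _ ⟨
    ∑< (m * r) (λ a → r * ∑< m (cellEdge (a / r)))            ≡⟨ ∑<-cong (m * r) (λ a _ → ∑<-blowUp m r _) ⟨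
    ∑< (m * r) (λ a → ∑< (m * r) (λ b → cellEdge (a / r) (b / r)))
      ≤⟨ ∑<-mono-≤ (m * r) (λ a _ → ∑<-monoˡ-≤ _ m*r≤n) ⟩
    ∑< (m * r) (λ a → ∑< n (λ b → cellEdge (a / r) (b / r)))  ≤⟨ ∑<-monoˡ-≤ _ m*r≤n ⟩
    ∑< n (λ a → ∑< n (λ b → cellEdge (a / r) (b / r)))        ≡⟨ edges≡∑< n ⟨
    edges (graph n)                                           ∎
    where open ℕ.≤-Reasoning

  cellDegree-≥3 : ∀ {i j} → i < w′ → j < w′ → 3 ≤ ∑< (w * w) (cellEdge (suc j * w + i))
  cellDegree-≥3 {i} {j} i<w′ j<w′ = begin
    3                                                           ≡⟨ cong₂ _+_ (cong₂ _+_ below itself) beside ⟨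
    cellEdge g (j * w + suc i) + cellEdge g g + cellEdge g (suc j * w + suc i)
      ≤⟨ ∑<-pick₃ (w * w) (cellEdge g) below<g g<beside beside<w*w ⟩
    ∑< (w * w) (cellEdge g)                                     ∎
    where
    open ℕ.≤-Reasoning
    g = suc j * w + i
    cell-g : cell g ≡ (i , suc j)
    cell-g = cell-rowMajor (suc j) (ℕ.m<n⇒m<1+n i<w′)
    near-g : ∀ g′ → Near (i , suc j) (cell g′) → cellEdge g g′ ≡ 1
    near-g g′ near = cellEdge-near {g} {g′} (subst (λ c → Near c (cell g′)) (sym cell-g) near)
    below : cellEdge g (j * w + suc i) ≡ 1
    below = near-g (j * w + suc i) (subst (Near (i , suc j)) (sym (cell-rowMajor j (s≤s i<w′))) diag)
    itself : cellEdge g g ≡ 1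
    itself = near-g g (subst (Near (i , suc j)) (sym cell-g) same)
    beside : cellEdge g (suc j * w + suc i) ≡ 1
    beside = near-g (suc j * w + suc i) (subst (Near (i , suc j)) (sym (cell-rowMajor (suc j) (s≤s i<w′))) right)
    below<g : j * w + suc i < g
    below<g = begin-strict
      j * w + suc i  <⟨ ℕ.+-monoʳ-< (j * w) (s≤s i<w′) ⟩
      j * w + w      ≡⟨ ℕ.+-comm (j * w) w ⟩
      suc j * w      ≤⟨ ℕ.m≤m+n _ i ⟩
      g              ∎
    g<beside : g < suc j * w + suc i
    g<beside = ℕ.+-monoʳ-< (suc j * w) (ℕ.n<1+n i)
    beside<w*w : suc j * w + suc i < w * w
    beside<w*w = begin-strict
      suc j * w + suc i  <⟨ ℕ.+-monoʳ-< (suc j * w) (s≤s i<w′) ⟩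
      suc j * w + w      ≡⟨ ℕ.+-comm (suc j * w) w ⟩
      suc (suc j) * w    ≤⟨ ℕ.*-monoˡ-≤ w (s≤s j<w′) ⟩
      w * w              ∎

  cellEdges-≥ : w′ * (w′ * 3) ≤ ∑< (w * w) (λ g → ∑< (w * w) (cellEdge g))
  cellEdges-≥ = begin
    w′ * (w′ * 3)
      ≡⟨ trans (∑<-cong w′ (λ _ _ → ∑<-const w′ 3)) (∑<-const w′ _) ⟨
    ∑< w′ (λ j → ∑< w′ (λ i → 3))
      ≤⟨ ∑<-mono-≤ w′ (λ j j<w′ → ∑<-mono-≤ w′ (λ i i<w′ → cellDegree-≥3 i<w′ j<w′)) ⟩
    ∑< w′ (λ j → ∑< w′ (λ i → degree (suc j * w + i)))
      ≤⟨ ∑<-mono-≤ w′ (λ j _ → ∑<-monoˡ-≤ _ (ℕ.n≤1+n w′)) ⟩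
    ∑< w′ (λ j → ∑< w (λ i → degree (suc j * w + i)))
      ≤⟨ ℕ.m≤n+m _ _ ⟩
    ∑< w (λ j → ∑< w (λ i → degree (j * w + i)))
      ≡⟨ ∑<-blocks w w degree ⟨
    ∑< (w * w) degree
      ∎
    where
    open ℕ.≤-Reasoning
    degree : ℕ → ℕ
    degree g = ∑< (w * w) (cellEdge g)

integerSqrt : ∀ m → Σ ℕ λ w → w * w ≤ m × m < suc w * suc w
integerSqrt zero = 0 , z≤n , s≤s z≤n
integerSqrt (suc m) with w , w²≤m , m<[1+w]² ← integerSqrt m | suc w * suc w ℕ.≤? suc m
... | yes [1+w]²≤1+m = suc w , [1+w]²≤1+m , ℕ.<-≤-trans (s≤s m<[1+w]²) (ℕ.*-mono-< (ℕ.n<1+n (suc w)) (ℕ.n<1+n (suc w)))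
... | no  [1+w]²≰1+m = w , ℕ.m≤n⇒m≤1+n w²≤m , ℕ.≰⇒> [1+w]²≰1+m

sparse-deficit² : ∀ r n e → n ≤ r → (3 * r * n ∸ e) ^ 2 ≤ 12 ^ 2 * (suc r ^ 3 * n)
sparse-deficit² r n e n≤r = begin
  (3 * r * n ∸ e) ^ 2
    ≤⟨ ℕ.^-monoˡ-≤ 2 (ℕ.m∸n≤m (3 * r * n) e) ⟩
  (3 * r * n) ^ 2
    ≡⟨ expand r n ⟩
  9 * (r * (r * (n * 1)) * n)
    ≤⟨ ℕ.*-monoʳ-≤ 9 (ℕ.*-monoˡ-≤ n (ℕ.*-monoʳ-≤ r (ℕ.*-monoʳ-≤ r (ℕ.*-monoˡ-≤ 1 n≤r)))) ⟩
  9 * (r ^ 3 * n)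
    ≤⟨ ℕ.*-mono-≤ (ℕ.m≤m+n 9 135) (ℕ.*-monoˡ-≤ n (ℕ.^-monoˡ-≤ 3 (ℕ.n≤1+n r))) ⟩
  12 ^ 2 * (suc r ^ 3 * n)
    ∎
  where
  open ℕ.≤-Reasoning
  expand : ∀ r n → 3 * r * n * (3 * r * n * 1) ≡ 9 * (r * (r * (n * 1)) * n)
  expand = solve-∀

grid-deficit : ∀ r w′ n e → n ≤ suc (suc w′) * suc (suc w′) * r → r * (r * (w′ * (w′ * 3))) ≤ e →
  3 * r * n ∸ e ≤ 12 * (r * (r * suc w′))
grid-deficit r w′ n e n≤[w+1]²r e≥ = ℕ.m≤n+o⇒m∸n≤o (3 * r * n) e (begin
  3 * r * n                                                  ≤⟨ ℕ.*-monoʳ-≤ (3 * r) n≤[w+1]²r ⟩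
  3 * r * (suc (suc w′) * suc (suc w′) * r)                  ≡⟨ expand r w′ ⟩
  r * (r * (w′ * (w′ * 3))) + 12 * (r * (r * suc w′))        ≤⟨ ℕ.+-monoˡ-≤ _ e≥ ⟩
  e + 12 * (r * (r * suc w′))                                ∎)
  where
  open ℕ.≤-Reasoning
  expand : ∀ r w′ → 3 * r * (suc (suc w′) * suc (suc w′) * r) ≡ r * (r * (w′ * (w′ * 3))) + 12 * (r * (r * suc w′))
  expand = solve-∀

grid-deficit² : ∀ r w n D → D ≤ 12 * (r * (r * w)) → w * w * r ≤ n → D ^ 2 ≤ 12 ^ 2 * (suc r ^ 3 * n)
grid-deficit² r w n D D≤ w²r≤n = begin
  D ^ 2                            ≤⟨ ℕ.^-monoˡ-≤ 2 D≤ ⟩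
  (12 * (r * (r * w))) ^ 2         ≡⟨ expand r w ⟩
  12 ^ 2 * (r ^ 3 * (w * w * r))   ≤⟨ ℕ.*-monoʳ-≤ (12 ^ 2) (ℕ.*-mono-≤ (ℕ.^-monoˡ-≤ 3 (ℕ.n≤1+n r)) w²r≤n) ⟩
  12 ^ 2 * (suc r ^ 3 * n)         ∎
  where
  open ℕ.≤-Reasoning
  expand : ∀ r w → 12 * (r * (r * w)) * (12 * (r * (r * w)) * 1) ≡ 144 * (r * (r * (r * 1)) * (w * w * r))
  expand = solve-∀

NearExtremal : ℕ → ℕ → ℕ → Set
NearExtremal C n k = Σ (BipGraph n) λ G → IsUGIG G × (¬ ContainsKkk k G) ×
  ((3 * (k ∸ 1) * n ∸ edges G) ^ 2 ≤ C ^ 2 * (k ^ 3 * n))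

ContainsKkk⇒edge : ∀ {n k} (G : BipGraph n) → ContainsKkk (suc k) G → Σ (Fin n) λ u → Σ (Fin n) λ v → G u v ≡ true
ContainsKkk⇒edge G (A , B , ∣A∣≡1+k , ∣B∣≡1+k , complete)
  with u , u∈A ← ∣p∣≡1+k⇒nonempty A ∣A∣≡1+k | v , v∈B ← ∣p∣≡1+k⇒nonempty B ∣B∣≡1+k
  = u , v , complete u v u∈A v∈B

edgeless : ∀ n → BipGraph n
edgeless n = crossingGraph (λ _ → (0 , 0)) (λ _ → (3 , 0))

edgeless-isUGIG : ∀ n → IsUGIG (edgeless n)
edgeless-isUGIG n = crossingGraph-isUGIG (λ _ → (0 , 0)) (λ _ → (3 , 0))

edgeless-¬ContainsKkk : ∀ n k → ¬ ContainsKkk (suc k) (edgeless n)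
edgeless-¬ContainsKkk n k K with () ← proj₂ (proj₂ (ContainsKkk⇒edge (edgeless n) K))

edgeless-nearExtremal : ∀ n r → n ≤ r → NearExtremal 12 n (suc r)
edgeless-nearExtremal n r n≤r = edgeless n , edgeless-isUGIG n , edgeless-¬ContainsKkk n r ,
  sparse-deficit² r n (edges (edgeless n)) n≤r

squareGrid-nearExtremal : ∀ r′ w′ n → suc w′ * suc w′ * suc r′ ≤ n → n ≤ suc (suc w′) * suc (suc w′) * suc r′ →
  NearExtremal 12 n (suc (suc r′))
squareGrid-nearExtremal r′ w′ n w²r≤n n≤[w+1]²r = graph n , graph-isUGIG n , graph-¬ContainsKkk n ,
  grid-deficit² r w n _ (grid-deficit r w′ n (edges (graph n)) n≤[w+1]²r edges-≥-square) w²r≤n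
  where
  open SquareGrid r′ w′
  edges-≥-square : r * (r * (w′ * (w′ * 3))) ≤ edges (graph n)
  edges-≥-square = ℕ.≤-trans (ℕ.*-monoʳ-≤ r (ℕ.*-monoʳ-≤ r cellEdges-≥)) (edges-≥ (w * w) n w²r≤n)

nearExtremal : ∀ n k → NearExtremal 12 n (suc k)
nearExtremal n zero = edgeless n , edgeless-isUGIG n , edgeless-¬ContainsKkk n 0 ,
  subst (λ d → d ^ 2 ≤ 12 ^ 2 * (1 ^ 3 * n)) (sym (ℕ.0∸n≡0 (edges (edgeless n)))) z≤n
nearExtremal n (suc r′) with n / suc r′ | /≡⇒window n (suc r′) refl
... | zero     | _ , n<r = edgeless-nearExtremal n (suc r′) (ℕ.<⇒≤ n<r)
... | suc m′   | m*r≤n , n<m*r+r with integerSqrt (suc m′)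
...   | zero   , _    , s≤s ()
...   | suc w′ , w²≤m , m<[w+1]² = squareGrid-nearExtremal r′ w′ n w²r≤n n≤[w+1]²r
  where
  w²r≤n : suc w′ * suc w′ * suc r′ ≤ n
  w²r≤n = ℕ.≤-trans (ℕ.*-monoˡ-≤ (suc r′) w²≤m) m*r≤n
  n≤[w+1]²r : n ≤ suc (suc w′) * suc (suc w′) * suc r′
  n≤[w+1]²r = ℕ.<⇒≤ (begin-strict
    n                               <⟨ n<m*r+r ⟩
    suc m′ * suc r′ + suc r′        ≡⟨ ℕ.+-comm _ (suc r′) ⟩
    suc (suc m′) * suc r′           ≤⟨ ℕ.*-monoˡ-≤ (suc r′) m<[w+1]² ⟩
    suc (suc w′) * suc (suc w′) * suc r′ ∎)
    where open ℕ.≤-Reasoning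

-- K_{0,0} lies in every graph, so 1 ≤ k is needed; 1 ≤ n is not.
theorem39 : Σ ℕ λ C → (1 ≤ C) ×
    ((n k : ℕ) → 1 ≤ n → 1 ≤ k →
      Σ (BipGraph n) λ G → IsUGIG G × (¬ ContainsKkk k G) ×
        ((3 * (k ∸ 1) * n ∸ edges G) ^ 2 ≤ C ^ 2 * (k ^ 3 * n)))
theorem39 = 12 , s≤s z≤n , λ { n zero _ () ; n (suc k) _ _ → nearExtremal n k }
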